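{- Let $\beta$ and $\gamma$ be loops in $G_n$ based at the same vertex $v$, and let $j\in[n]$ be such that $\mathrm{Drift}_\beta(j)=\mathrm{Drift}_\gamma(j)=0$. Then $\mathrm{Drift}_{\beta\gamma}(j)=0$, where $\beta\gamma$ is the concatenated loop.
   Context: $[n]=\{1,\dots,n\}$. For distinct reals $y_1,\dots,y_n$, $\mathrm{Order}(y_1,\dots,y_n)$ is the unique $\sigma\in S_n$ with $y_i<y_j$ iff $\sigma(i)<\sigma(j)$. $\rho,\rho':S_{n+1}\to S_n$: $\rho(\sigma)=\mathrm{Order}(\sigma(1),\dots,\sigma(n))$, $\rho'(\sigma)=\mathrm{Order}(\sigma(2),\dots,\sigma(n+1))$. The permutation digraph $G_n$ has vertex set $S_n$ and edge set $S_{n+1}$, edge $e$ directed from $\rho(e)$ to $\rho'(e)$. A path of length $\ell$ is $(v_0,e_1,v_1,\dots,e_\ell,v_\ell)$ with $e_i$ directed from $v_{i-1}$ to $v_i$; a loop based at $v_0$ is a finite path of length $\ell\ge1$ with $v_\ell=v_0$; concatenation of loops based at the same vertex is the obvious one. For a path $p$ of length $\ell$ let $Q_p=\{x_1,\dots,x_{\ell+n}\}$ with $\le$ the reflexive-transitive closure of: $x_{a+c}\le x_{a+d}$ when $0\le a\le\ell$, $c,d\in[n]$, $v_a(c)\le v_a(d)$; $x_{a-1+c}\le x_{a-1+d}$ when $1\le a\le\ell$, $c,d\in[n+1]$, $e_a(c)\le e_a(d)$. For a loop $\gamma$ of length $\ell$ and $j\in[n]$, $\mathrm{Drift}_\gamma(j)=+$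 if $x_j\le x_{\ell+j}$ in $Q_\gamma$, $-$ if $x_j\ge x_{\ell+j}$, and $0$ if they are incomparable. -}

module Defs where

open import Data.Nat using (ℕ; zero; suc; _+_; _≤_)
open import Data.Fin using (Fin; toℕ; inject₁; fromℕ; zero; suc)
  renaming (_<_ to _<ᶠ_; _≤_ to _≤ᶠ_)
open import Data.Fin.Permutation using (Permutation′; _⟨$⟩ʳ_; _≈_)
open import Data.Vec using (Vec; lookup; _++_; tail)
open import Data.Product using (_×_)
open import Function.Bundles using (_⇔_)
open import Relation.Binary.Construct.Closure.ReflexiveTransitive using (Star)
open import Relation.Nullary using (¬_)

-- S_n : permutations of Fin n (0-indexed version of [n]).
Perm : ℕ → Set
Perm n = Permutation′ n

-- σ = Order(y_1,…,y_k) : the defining property of Order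
-- (y_i < y_j iff σ(i) < σ(j)).  Order is unique, so "Order(y) = σ" is
-- exactly "IsOrder σ y".
IsOrder : ∀ {k m} → Perm k → (Fin k → Fin m) → Set
IsOrder σ y = ∀ i j → (y i <ᶠ y j) ⇔ ((σ ⟨$⟩ʳ i) <ᶠ (σ ⟨$⟩ʳ j))

ρ-is : ∀ {n} → Perm (suc n) → Perm n → Set
ρ-is e v = IsOrder v (λ i → e ⟨$⟩ʳ inject₁ i)

ρ'-is : ∀ {n} → Perm (suc n) → Perm n → Set
ρ'-is e v = IsOrder v (λ i → e ⟨$⟩ʳ suc i)

-- Raw data of a path of length ℓ in G_n : vertices v_0,…,v_ℓ and edges
-- e_1,…,e_ℓ (stored 0-indexed).
record RawPath (n ℓ : ℕ) : Set where
  constructor mkPath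
  field
    vert : Vec (Perm n) (suc ℓ)
    edge : Vec (Perm (suc n)) ℓ
open RawPath public

IsPath : ∀ {n ℓ} → RawPath n ℓ → Set
IsPath {n} {ℓ} p = ∀ (a : Fin ℓ) →
  ρ-is (lookup (edge p) a) (lookup (vert p) (inject₁ a)) ×
  ρ'-is (lookup (edge p) a) (lookup (vert p) (suc a))

IsLoop : ∀ {n ℓ} → RawPath n ℓ → Set
IsLoop {n} {ℓ} p = IsPath p × (1 ≤ ℓ) ×
  (lookup (vert p) (fromℕ ℓ) ≈ lookup (vert p) zero)

BasedAt : ∀ {n ℓ} → RawPath n ℓ → Perm n → Set
BasedAt p v = lookup (vert p) zero ≈ v

-- concatenation β γ (γ's initial vertex is identified with β's final one)
concat : ∀ {n ℓ₁ ℓ₂} → RawPath n ℓ₁ → RawPath n ℓ₂ → RawPath n (ℓ₁ + ℓ₂)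
concat β γ = mkPath (vert β ++ tail (vert γ)) (edge β ++ edge γ)

-- Generating relations of Q_p on indices 0,…,ℓ+n-1 (x_{k+1} ↦ k).
data Gen {n ℓ : ℕ} (p : RawPath n ℓ) : ℕ → ℕ → Set where
  vgen : (a : Fin (suc ℓ)) (c d : Fin n) →
         (lookup (vert p) a ⟨$⟩ʳ c) ≤ᶠ (lookup (vert p) a ⟨$⟩ʳ d) →
         Gen p (toℕ a + toℕ c) (toℕ a + toℕ d)
  egen : (a : Fin ℓ) (c d : Fin (suc n)) →
         (lookup (edge p) a ⟨$⟩ʳ c) ≤ᶠ (lookup (edge p) a ⟨$⟩ʳ d) →
         Gen p (toℕ a + toℕ c) (toℕ a + toℕ d)

Q≤ : ∀ {n ℓ} → RawPath n ℓ → ℕ → ℕ → Set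
Q≤ p = Star (Gen p)

-- Drift_γ(j) = 0 : x_j and x_{ℓ+j} incomparable in Q_γ (j 0-indexed)
DriftZero : ∀ {n ℓ} → RawPath n ℓ → Fin n → Set
DriftZero {n} {ℓ} p j =
  ¬ Q≤ p (toℕ j) (ℓ + toℕ j) × ¬ Q≤ p (ℓ + toℕ j) (toℕ j)

-- Every path p has a realization: values f(x_1), …, f(x_{ℓ+n}) in ℕ such that each
-- window of n (resp. n+1) consecutive values has the pattern of the corresponding
-- vertex (resp. edge); it is built by inserting the points one at a time from the front.
-- A realization is a linear extension of Q_p, so Q_p induces on the a-th window exactly
-- the order v_a.  Now Q_{βγ} is generated by Q_β and a copy of Q_γ shifted by ℓ₁, which
-- overlap in the window of the common vertex v, where both induce the order of v.
-- Hence a chain from x_j up to x_{ℓ₁+ℓ₂+j} can be rerouted to cross that window once: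
-- x_j ≤ x_{ℓ₁+k} in Q_β and x_k ≤ x_{ℓ₂+j} in Q_γ for some k.  If v(k) ≤ v(j) this gives
-- x_j ≤ x_{ℓ₁+j} in Q_β, otherwise x_j ≤ x_{ℓ₂+j} in Q_γ, contradicting a zero drift.
-- The downward direction is symmetric.
module Submission where

open import Defs
open import Data.Nat using (ℕ; zero; suc; _+_; _∸_; _≤_; _<_; _<?_; z≤n; s≤s)
open import Data.Nat.Properties
  using (≤-refl; ≤-trans; <-trans; <⇒≤; <⇒≱; ≮⇒≥; <-irrefl; n<1+n; +-suc; +-assoc;
         +-mono-≤; +-mono-≤-<; +-mono-<-≤; +-cancelˡ-<; m≤m+n; m≤n+m; m+n∸m≡n;
         m+[n∸m]≡n; m≤n⇒m<n∨m≡n)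
open import Data.Fin using (Fin; toℕ; inject₁; fromℕ; fromℕ<; zero; suc; _↑ˡ_; _↑ʳ_)
  renaming (_<_ to _<ᶠ_; _≤_ to _≤ᶠ_)
open import Data.Fin.Properties
  using (toℕ-injective; toℕ<n; toℕ≤pred[n]; toℕ-fromℕ; toℕ-fromℕ<; fromℕ<-toℕ;
         toℕ-↑ˡ; toℕ-↑ʳ; toℕ-inject₁)
  renaming (≤-total to ≤ᶠ-total; _<?_ to _<ᶠ?_)
open import Data.Fin.Permutation using (_⟨$⟩ʳ_; _≈_)
open import Data.Vec using (lookup; _∷_; []; _++_)
open import Data.Vec.Properties using (lookup-++ˡ; lookup-++ʳ)
open import Data.List using (tabulate)
open import Data.List.Extrema.Nat using (max; xs≤max; max<v⁺)
open import Data.List.Relation.Unary.All.Properties using (tabulate⁺; tabulate⁻)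
open import Data.Product using (_×_; _,_; proj₁; proj₂; ∃)
open import Data.Sum using (inj₁; inj₂; swap; [_,_]′)
open import Function using (_∘_; id)
open import Function.Bundles using (_⇔_; mk⇔; Equivalence; Injection)
open import Function.Properties.Inverse using (↔⇒↣)
open import Level using (0ℓ)
open import Relation.Binary using (Rel)
open import Relation.Binary.Construct.Union using (_∪_)
open import Relation.Binary.Construct.Closure.ReflexiveTransitive
  using (Star; ε; _◅_; _◅◅_; gmap; map; fold; gfoldl)
open import Relation.Binary.PropositionalEquality
  using (_≡_; refl; sym; trans; cong; subst; subst₂)
open import Relation.Nullary using (¬_; yes; no; contradiction)
open import Relation.Unary using (Pred)

open Equivalence using (to; from)

⟨$⟩ʳ-injective : ∀ {n} (σ : Perm n) {c d : Fin n} → σ ⟨$⟩ʳ c ≡ σ ⟨$⟩ʳ d → c ≡ d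
⟨$⟩ʳ-injective σ = Injection.injective (↔⇒↣ σ)

Realizes : ∀ {k m} → (Fin k → Fin m) → (Fin k → ℕ) → Set
Realizes y g = ∀ c d → y c <ᶠ y d → g c < g d

realizes-≤ : ∀ {k} (σ : Perm k) {g : Fin k → ℕ} → Realizes (σ ⟨$⟩ʳ_) g →
  ∀ {c d} → σ ⟨$⟩ʳ c ≤ᶠ σ ⟨$⟩ʳ d → g c ≤ g d
realizes-≤ σ R {c} {d} σc≤σd with m≤n⇒m<n∨m≡n σc≤σd
... | inj₁ σc<σd = <⇒≤ (R c d σc<σd)
... | inj₂ σc≡σd with ⟨$⟩ʳ-injective σ (toℕ-injective σc≡σd)
...   | refl = ≤-refl

realizes-cong : ∀ {k m} {y : Fin k → Fin m} {g h : Fin k → ℕ} →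
  (∀ c → g c ≡ h c) → Realizes y g → Realizes y h
realizes-cong g≗h R c d lt = subst₂ _<_ (g≗h c) (g≗h d) (R c d lt)

realizes-IsOrder : ∀ {k m} {σ : Perm k} {y : Fin k → Fin m} {g : Fin k → ℕ} →
  IsOrder σ y → Realizes y g ⇔ Realizes (σ ⟨$⟩ʳ_) g
realizes-IsOrder σ-order = mk⇔
  (λ R c d → R c d ∘ from (σ-order c d))
  (λ R c d → R c d ∘ to (σ-order c d))

window : ∀ {k} → ℕ → (ℕ → ℕ) → Fin k → ℕ
window a f c = f (a + toℕ c)

record Realization {n ℓ} (p : RawPath n ℓ) (f : ℕ → ℕ) : Set where
  field
    vertices : ∀ a → Realizes (lookup (vert p) a ⟨$⟩ʳ_) (window (toℕ a) f)
    edges    : ∀ a → Realizes (lookup (edge p) a ⟨$⟩ʳ_) (window (toℕ a) f)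

module _ {n ℓ} {p : RawPath n ℓ} {f : ℕ → ℕ} (R : Realization p f) where
  open Realization R

  Gen-monotone : ∀ {x y} → Gen p x y → f x ≤ f y
  Gen-monotone (vgen a c d le) = realizes-≤ (lookup (vert p) a) (vertices a) le
  Gen-monotone (egen a c d le) = realizes-≤ (lookup (edge p) a) (edges a) le

  Q≤-monotone : ∀ {x y} → Q≤ p x y → f x ≤ f y
  Q≤-monotone = fold (λ x y → f x ≤ f y) (≤-trans ∘ Gen-monotone) ≤-refl

stretch : ℕ → ℕ
stretch x = suc (x + x)

stretch-gap : ∀ {x y} → x < y → suc (suc (stretch x)) ≤ stretch y
stretch-gap {x} {suc y} (s≤s x≤y) =
  s≤s (s≤s (subst (suc (x + x) ≤_) (sym (+-suc y y)) (s≤s (+-mono-≤ x≤y x≤y))))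

stretch-mono : ∀ {x y} → x < y → stretch x < stretch y
stretch-mono x<y = <-trans (n<1+n _) (stretch-gap x<y)

realizes-stretch : ∀ {k m} {y : Fin k → Fin m} {g : Fin k → ℕ} →
  Realizes y g → Realizes y (stretch ∘ g)
realizes-stretch R c d = stretch-mono ∘ R c d

_◂_ : ℕ → (ℕ → ℕ) → ℕ → ℕ
(g ◂ t) zero    = g
(g ◂ t) (suc x) = t x

module Insertion {n} (e : Perm (suc n)) (t : ℕ → ℕ)
  (t-realizes : Realizes (λ d → e ⟨$⟩ʳ suc d) (window 0 t)) where

  bound : Fin n → ℕ
  bound d with e ⟨$⟩ʳ suc d <ᶠ? e ⟨$⟩ʳ zero
  ... | yes _ = suc (stretch (t (toℕ d)))
  ... | no _  = 0

  -- Stretched values are odd, so this even number lies just above every stretched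
  -- value that e puts below its first entry and still below all the others.
  first : ℕ
  first = max 0 (tabulate bound)

  below-first : ∀ d → e ⟨$⟩ʳ suc d <ᶠ e ⟨$⟩ʳ zero → stretch (t (toℕ d)) < first
  below-first d below
    with e ⟨$⟩ʳ suc d <ᶠ? e ⟨$⟩ʳ zero | tabulate⁻ (xs≤max 0 (tabulate bound)) d
  ... | yes _     | bound≤first = bound≤first
  ... | no ¬below | _           = contradiction below ¬below

  first-below : ∀ d → e ⟨$⟩ʳ zero <ᶠ e ⟨$⟩ʳ suc d → first < stretch (t (toℕ d))
  first-below d above = max<v⁺ (s≤s z≤n) (tabulate⁺ bound<)
    where
    bound< : ∀ d′ → bound d′ < stretch (t (toℕ d))
    bound< d′ with e ⟨$⟩ʳ suc d′ <ᶠ? e ⟨$⟩ʳ zero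
    ... | yes below = stretch-gap (t-realizes d′ d (<-trans below above))
    ... | no _      = s≤s z≤n

  realizes-insertion : Realizes (e ⟨$⟩ʳ_) (window 0 (first ◂ (stretch ∘ t)))
  realizes-insertion zero    zero    lt = contradiction lt (<-irrefl refl)
  realizes-insertion zero    (suc d) lt = first-below d lt
  realizes-insertion (suc c) zero    lt = below-first c lt
  realizes-insertion (suc c) (suc d) lt = stretch-mono (t-realizes c d lt)

extend : ∀ {n} → (Fin n → ℕ) → ℕ → ℕ
extend {n} g x with x <? n
... | yes x<n = g (fromℕ< x<n)
... | no _    = 0

extend-toℕ : ∀ {n} (g : Fin n → ℕ) (c : Fin n) → extend g (toℕ c) ≡ g c
extend-toℕ {n} g c with toℕ c <? n
... | yes c<n = cong g (fromℕ<-toℕ c c<n)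
... | no c≮n  = contradiction (toℕ<n c) c≮n

realization : ∀ {n ℓ} (p : RawPath n ℓ) → IsPath p → ∃ (Realization p)
realization (mkPath (v ∷ []) []) _ = extend (λ c → toℕ (v ⟨$⟩ʳ c)) , record
  { vertices = λ { zero → realizes-cong (λ c → sym (extend-toℕ _ c)) (λ _ _ lt → lt) }
  ; edges    = λ () }
realization (mkPath (v ∷ vs) (e ∷ es)) p-path with realization (mkPath vs es) (p-path ∘ suc)
... | f , R = F , record { vertices = vertices′ ; edges = edges′ }
  where
  open Realization R
  open Insertion e f (from (realizes-IsOrder {σ = lookup vs zero} (proj₂ (p-path zero))) (vertices zero))

  F : ℕ → ℕ
  F = first ◂ (stretch ∘ f)

  edges′ : ∀ a → Realizes (lookup (e ∷ es) a ⟨$⟩ʳ_) (window (toℕ a) F)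
  edges′ zero    = realizes-insertion
  edges′ (suc a) = realizes-stretch (edges a)

  vertices′ : ∀ a → Realizes (lookup (v ∷ vs) a ⟨$⟩ʳ_) (window (toℕ a) F)
  vertices′ zero    = realizes-cong (λ c → cong F (toℕ-inject₁ c))
    (to (realizes-IsOrder {σ = v} (proj₁ (p-path zero)))
        (λ c d → realizes-insertion (inject₁ c) (inject₁ d)))
  vertices′ (suc a) = realizes-stretch (vertices a)

window-faithful : ∀ {n ℓ} {p : RawPath n ℓ} → IsPath p → (a : Fin (suc ℓ)) {k m : Fin n} →
  Q≤ p (toℕ a + toℕ k) (toℕ a + toℕ m) →
  lookup (vert p) a ⟨$⟩ʳ k ≤ᶠ lookup (vert p) a ⟨$⟩ʳ m
window-faithful p-path a {k} {m} q with realization _ p-path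
... | f , R = ≮⇒≥ λ m<k → <⇒≱ (Realization.vertices R a m k m<k) (Q≤-monotone R q)

vgen-at : ∀ {n ℓ} {p : RawPath n ℓ} (a : Fin (suc ℓ)) {σ : Perm n} {t : ℕ} →
  lookup (vert p) a ≡ σ → toℕ a ≡ t →
  ∀ {c d} → σ ⟨$⟩ʳ c ≤ᶠ σ ⟨$⟩ʳ d → Gen p (t + toℕ c) (t + toℕ d)
vgen-at a refl refl = vgen a _ _

egen-at : ∀ {n ℓ} {p : RawPath n ℓ} (a : Fin ℓ) {σ : Perm (suc n)} {t : ℕ} →
  lookup (edge p) a ≡ σ → toℕ a ≡ t →
  ∀ {c d} → σ ⟨$⟩ʳ c ≤ᶠ σ ⟨$⟩ʳ d → Gen p (t + toℕ c) (t + toℕ d)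
egen-at a refl refl = egen a _ _

window-order : ∀ {n ℓ} {p : RawPath n ℓ} → IsPath p → (a : Fin (suc ℓ)) {σ : Perm n} {t : ℕ} →
  lookup (vert p) a ≈ σ → toℕ a ≡ t →
  ∀ {k m} → Q≤ p (t + toℕ k) (t + toℕ m) ⇔ (σ ⟨$⟩ʳ k ≤ᶠ σ ⟨$⟩ʳ m)
window-order {p = p} p-path a {σ} a≈σ refl {k} {m} = mk⇔
  (λ q → subst₂ _≤ᶠ_ (a≈σ k) (a≈σ m) (window-faithful p-path a q))
  (λ le → vgen a k m (subst₂ _≤ᶠ_ (sym (a≈σ k)) (sym (a≈σ m)) le) ◅ ε)

module Amalgamation {I : Set} {A B : Rel I 0ℓ} {InA InB : Pred I 0ℓ}
  (A-inside : ∀ {x y} → A x y → InA x × InA y)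
  (B-inside : ∀ {x y} → B x y → InB x × InB y)
  (B⇒A-overlap : ∀ {c y} → InA c → InB c → InA y → InB y → Star B c y → Star A c y)
  where

  record Factorisation (x z : I) : Set where
    constructor factorisation
    field
      {pivot} : I
      pivot-A : InA pivot
      pivot-B : InB pivot
      A-part  : Star A x pivot
      B-part  : Star B pivot z

  data Scan (x y : I) : Set where
    within-A : Star A x y → InA y → Scan x y
    crossed  : Factorisation x y → InB y → Scan x y

  scan-step : ∀ {x y z} → Scan x y → (A ∪ B) y z → Scan x z
  scan-step (within-A s _) (inj₁ a) = within-A (s ◅◅ a ◅ ε) (proj₂ (A-inside a))
  scan-step (within-A s yA) (inj₂ b) =
    crossed (factorisation yA (proj₁ (B-inside b)) s (b ◅ ε)) (proj₂ (B-inside b))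
  scan-step (crossed (factorisation cA cB s₁ s₂) _) (inj₂ b) =
    crossed (factorisation cA cB s₁ (s₂ ◅◅ b ◅ ε)) (proj₂ (B-inside b))
  -- Returning to A from B happens at a point of the overlap, so the B-excursion
  -- since the pivot can be replaced by an A-chain.
  scan-step (crossed (factorisation cA cB s₁ s₂) yB) (inj₁ a) =
    within-A (s₁ ◅◅ B⇒A-overlap cA cB (proj₁ (A-inside a)) yB s₂ ◅◅ a ◅ ε) (proj₂ (A-inside a))

  factorise : ∀ {x z} → InA x → InB z → Star (A ∪ B) x z → Factorisation x z
  factorise xA zB s with gfoldl id Scan scan-step (within-A ε xA) s
  ... | within-A s′ zA = factorisation zA zB s′ ε
  ... | crossed f _    = f

-- The bounds keep the truncated subtraction honest.
Translate : ℕ → Rel ℕ 0ℓ → Rel ℕ 0ℓ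
Translate s R x y = s ≤ x × s ≤ y × R (x ∸ s) (y ∸ s)

translate : ∀ {s} {R : Rel ℕ 0ℓ} {t u x y} → s + t ≡ x → s + u ≡ y → R t u → Translate s R x y
translate {s} {R} {t} {u} refl refl r =
  m≤m+n s t , m≤m+n s u , subst₂ R (sym (m+n∸m≡n s t)) (sym (m+n∸m≡n s u)) r

translate⋆ : ∀ {s} {R : Rel ℕ 0ℓ} {t u} → Star R t u → Star (Translate s R) (s + t) (s + u)
translate⋆ {s} {R} = gmap (s +_) (translate {R = R} refl refl)

untranslate⋆ : ∀ {s} {R : Rel ℕ 0ℓ} {t u} → Star (Translate s R) (s + t) (s + u) → Star R t u
untranslate⋆ {s} {R} {t} {u} st =
  subst₂ (Star R) (m+n∸m≡n s t) (m+n∸m≡n s u) (gmap (_∸ s) (proj₂ ∘ proj₂) st)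

data SplitView (m n : ℕ) : Fin (m + n) → Set where
  left  : (i : Fin m) → SplitView m n (i ↑ˡ n)
  right : (i : Fin n) → SplitView m n (m ↑ʳ i)

splitView : ∀ m {n} (a : Fin (m + n)) → SplitView m n a
splitView zero    a       = right a
splitView (suc m) zero    = left zero
splitView (suc m) (suc a) with splitView m a
... | left i  = left (suc i)
... | right i = right i

↑ʳ-offset : ∀ {n} m (i : Fin n) c → m + (toℕ i + c) ≡ toℕ (m ↑ʳ i) + c
↑ʳ-offset m i c = trans (sym (+-assoc m (toℕ i) c)) (cong (_+ c) (sym (toℕ-↑ʳ m i)))

Gen-concat : ∀ {n ℓ₁ ℓ₂} (β : RawPath n ℓ₁) (γ : RawPath n ℓ₂) {x y} →
  Gen (concat β γ) x y → (Gen β ∪ Translate ℓ₁ (Gen γ)) x y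
Gen-concat {ℓ₁ = ℓ₁} {ℓ₂} β γ@(mkPath (_ ∷ ws) _) (vgen a c d le) with splitView (suc ℓ₁) a
... | left i  = inj₁ (vgen-at i (sym (lookup-++ˡ (vert β) ws i)) (sym (toℕ-↑ˡ i ℓ₂)) le)
... | right i = inj₂ (translate {R = Gen γ} (offset c) (offset d)
                       (vgen-at {p = γ} (suc i) (sym (lookup-++ʳ (vert β) ws i)) refl le))
  where
  offset : ∀ c → ℓ₁ + (suc (toℕ i) + toℕ c) ≡ toℕ (suc ℓ₁ ↑ʳ i) + toℕ c
  offset c = trans (+-suc ℓ₁ _) (↑ʳ-offset (suc ℓ₁) i (toℕ c))
Gen-concat {ℓ₁ = ℓ₁} {ℓ₂} β γ (egen a c d le) with splitView ℓ₁ a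
... | left i  = inj₁ (egen-at i (sym (lookup-++ˡ (edge β) (edge γ) i)) (sym (toℕ-↑ˡ i ℓ₂)) le)
... | right i = inj₂ (translate {R = Gen γ} (↑ʳ-offset ℓ₁ i (toℕ c)) (↑ʳ-offset ℓ₁ i (toℕ d))
                       (egen-at {p = γ} i (sym (lookup-++ʳ (edge β) (edge γ) i)) refl le))

module Concatenation {n ℓ₁ ℓ₂} (β : RawPath n ℓ₁) (γ : RawPath n ℓ₂)
  (β-path : IsPath β) (γ-path : IsPath γ)
  (composable : lookup (vert β) (fromℕ ℓ₁) ≈ lookup (vert γ) zero)
  where

  σ : Perm n
  σ = lookup (vert γ) zero

  β-window : ∀ {k m} → Q≤ β (ℓ₁ + toℕ k) (ℓ₁ + toℕ m) ⇔ (σ ⟨$⟩ʳ k ≤ᶠ σ ⟨$⟩ʳ m)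
  β-window = window-order {p = β} β-path (fromℕ ℓ₁) {σ} composable (toℕ-fromℕ ℓ₁)

  γ-window : ∀ {k m} → Q≤ γ (toℕ k) (toℕ m) ⇔ (σ ⟨$⟩ʳ k ≤ᶠ σ ⟨$⟩ʳ m)
  γ-window = window-order {p = γ} γ-path zero {σ} (λ _ → refl) refl

  InBeta InGamma : Pred ℕ 0ℓ
  InBeta x  = x < ℓ₁ + n
  InGamma x = ℓ₁ ≤ x

  Gen-γ↑ : Rel ℕ 0ℓ
  Gen-γ↑ = Translate ℓ₁ (Gen γ)

  Gen-β-inside : ∀ {x y} → Gen β x y → InBeta x × InBeta y
  Gen-β-inside (vgen a c d _) =
    +-mono-≤-< (toℕ≤pred[n] a) (toℕ<n c) , +-mono-≤-< (toℕ≤pred[n] a) (toℕ<n d)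
  Gen-β-inside (egen a c d _) =
    +-mono-<-≤ (toℕ<n a) (toℕ≤pred[n] c) , +-mono-<-≤ (toℕ<n a) (toℕ≤pred[n] d)

  Gen-γ↑-inside : ∀ {x y} → Gen-γ↑ x y → InGamma x × InGamma y
  Gen-γ↑-inside (ℓ₁≤x , ℓ₁≤y , _) = ℓ₁≤x , ℓ₁≤y

  overlap-index : ∀ {c} → InBeta c → InGamma c → ∃ λ (k : Fin n) → c ≡ ℓ₁ + toℕ k
  overlap-index {c} cβ cγ =
    fromℕ< c∸ℓ₁<n , sym (trans (cong (ℓ₁ +_) (toℕ-fromℕ< c∸ℓ₁<n)) (m+[n∸m]≡n cγ))
    where
    c∸ℓ₁<n : c ∸ ℓ₁ < n
    c∸ℓ₁<n = +-cancelˡ-< ℓ₁ _ _ (subst (_< ℓ₁ + n) (sym (m+[n∸m]≡n cγ)) cβ)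

  γ↑⇒β-overlap : ∀ {c y} → InBeta c → InGamma c → InBeta y → InGamma y →
    Star Gen-γ↑ c y → Q≤ β c y
  γ↑⇒β-overlap cβ cγ yβ yγ s with overlap-index cβ cγ | overlap-index yβ yγ
  ... | k , refl | m , refl = from β-window (to γ-window (untranslate⋆ s))

  β⇒γ↑-overlap : ∀ {c y} → InGamma c → InBeta c → InGamma y → InBeta y →
    Q≤ β c y → Star Gen-γ↑ c y
  β⇒γ↑-overlap cγ cβ yγ yβ s with overlap-index cβ cγ | overlap-index yβ yγ
  ... | k , refl | m , refl = translate⋆ (from γ-window (to β-window s))

  module Upward   = Amalgamation Gen-β-inside Gen-γ↑-inside γ↑⇒β-overlap
  module Downward = Amalgamation Gen-γ↑-inside Gen-β-inside β⇒γ↑-overlap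

  Q≤-concat-upward : ∀ {x z} → InBeta x → Q≤ (concat β γ) x (ℓ₁ + z) →
    ∃ λ k → Q≤ β x (ℓ₁ + toℕ k) × Q≤ γ (toℕ k) z
  Q≤-concat-upward {z = z} xβ q
    with Upward.factorise xβ (m≤m+n ℓ₁ z) (map (Gen-concat β γ) q)
  ... | Upward.factorisation cβ cγ s₁ s₂ with overlap-index cβ cγ
  ...   | k , refl = k , s₁ , untranslate⋆ s₂

  Q≤-concat-downward : ∀ {x z} → InBeta x → Q≤ (concat β γ) (ℓ₁ + z) x →
    ∃ λ k → Q≤ γ z (toℕ k) × Q≤ β (ℓ₁ + toℕ k) x
  Q≤-concat-downward {z = z} xβ q
    with Downward.factorise (m≤m+n ℓ₁ z) xβ (map (swap ∘ Gen-concat β γ) q)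
  ... | Downward.factorisation cγ cβ s₁ s₂ with overlap-index cβ cγ
  ...   | k , refl = k , untranslate⋆ s₁ , s₂

  DriftZero-concat : ∀ j → DriftZero β j → DriftZero γ j → DriftZero (concat β γ) j
  DriftZero-concat j (β-up , β-down) (γ-up , γ-down) =
    up ∘ subst (Q≤ (concat β γ) (toℕ j)) (+-assoc ℓ₁ ℓ₂ (toℕ j)) ,
    down ∘ subst (λ x → Q≤ (concat β γ) x (toℕ j)) (+-assoc ℓ₁ ℓ₂ (toℕ j))
    where
    j-in-β : InBeta (toℕ j)
    j-in-β = ≤-trans (toℕ<n j) (m≤n+m n ℓ₁)

    up : ¬ Q≤ (concat β γ) (toℕ j) (ℓ₁ + (ℓ₂ + toℕ j))
    up q =
      let k , j≤k , k≤j′ = Q≤-concat-upward j-in-β q in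
      [ (λ σk≤σj → β-up (j≤k ◅◅ from (β-window {k} {j}) σk≤σj))
      , (λ σj≤σk → γ-up (from (γ-window {j} {k}) σj≤σk ◅◅ k≤j′))
      ]′ (≤ᶠ-total (σ ⟨$⟩ʳ k) (σ ⟨$⟩ʳ j))

    down : ¬ Q≤ (concat β γ) (ℓ₁ + (ℓ₂ + toℕ j)) (toℕ j)
    down q =
      let k , j′≤k , k≤j = Q≤-concat-downward j-in-β q in
      [ (λ σj≤σk → β-down (from (β-window {j} {k}) σj≤σk ◅◅ k≤j))
      , (λ σk≤σj → γ-down (j′≤k ◅◅ from (γ-window {k} {j}) σk≤σj))
      ]′ (≤ᶠ-total (σ ⟨$⟩ʳ j) (σ ⟨$⟩ʳ k))

lemma4p5 : ∀ {n ℓ₁ ℓ₂ : ℕ} (v : Perm n) (β : RawPath n ℓ₁) (γ : RawPath n ℓ₂) →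
    IsLoop β → IsLoop γ → BasedAt β v → BasedAt γ v →
    (j : Fin n) → DriftZero β j → DriftZero γ j →
    DriftZero (concat β γ) j
lemma4p5 v β γ (β-path , _ , β-closed) (γ-path , _ , _) β-at-v γ-at-v =
  Concatenation.DriftZero-concat β γ β-path γ-path composable
  where
  composable : lookup (vert β) (fromℕ _) ≈ lookup (vert γ) zero
  composable i = trans (β-closed i) (trans (β-at-v i) (sym (γ-at-v i)))
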